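{- Let $G=(V,E)$ be a finite graph, $S\subseteq V$, and $s\in S$. Then $$|\mathsf{VC}(G,S)|\leq \left(\frac{2^{d(s)}}{1+2^{d(s)}}\right)|\mathsf{VC}(G,S\setminus\{s\})|.$$
   Context: A vertex cover of $G=(V,E)$ is a set $C\subseteq V$ such that $\{u,v\}\cap C\neq\emptyset$ for every edge $\{u,v\}\in E$. For $S\subseteq V$, $\mathsf{VC}(G,S)$ denotes the set of vertex covers of $G$ containing $S$. For a vertex $s$, $N_s$ is the set of neighbours of $s$ and $d(s)=|N_s|$. -}

module Defs where

open import Data.Nat using (ℕ; zero; suc)
open import Data.Bool using (Bool; true; false)
open import Data.Fin using (Fin)
open import Data.Fin.Subset using (Subset; _∈_; _⊆_; ∣_∣)
open import Data.Fin.Subset.Properties using (_∈?_; _⊆?_)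
open import Data.Fin.Properties using (all?)
open import Data.Vec using (Vec; []; _∷_; tabulate)
open import Data.List using (List; []; _∷_; map; _++_; filter; length)
open import Data.Sum using (_⊎_)
open import Data.Product using (_×_)
open import Relation.Binary.PropositionalEquality using (_≡_)
open import Relation.Nullary using (Dec; yes; no)
open import Relation.Nullary.Decidable using (_⊎-dec_; _×-dec_; _→-dec_)
open import Data.Bool.Properties using () renaming (_≟_ to _≟ᵇ_)

record Graph (n : ℕ) : Set where
  field
    adj   : Fin n → Fin n → Bool
    sym   : ∀ u v → adj u v ≡ adj v u
    irrefl : ∀ u → adj u u ≡ false

open Graph public

Edge : ∀ {n} → Graph n → Fin n → Fin n → Set
Edge G u v = adj G u v ≡ true

IsVertexCover : ∀ {n} → Graph n → Subset n → Set
IsVertexCover G C = ∀ u v → Edge G u v → (u ∈ C) ⊎ (v ∈ C)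

isVertexCover? : ∀ {n} (G : Graph n) (C : Subset n) → Dec (IsVertexCover G C)
isVertexCover? G C =
  all? λ u → all? λ v → (adj G u v ≟ᵇ true) →-dec ((u ∈? C) ⊎-dec (v ∈? C))

allSubsets : ∀ n → List (Subset n)
allSubsets zero = [] ∷ []
allSubsets (suc n) = map (true ∷_) (allSubsets n) ++ map (false ∷_) (allSubsets n)

numVC : ∀ {n} → Graph n → Subset n → ℕ
numVC G S = length (filter (λ C → (S ⊆? C) ×-dec isVertexCover? G C) (allSubsets _))

nbhd : ∀ {n} → Graph n → Fin n → Subset n
nbhd G s = tabulate (adj G s)

deg : ∀ {n} → Graph n → Fin n → ℕ
deg G s = ∣ nbhd G s ∣

-- Sending a cover C ⊇ S to (C ∖ {s}) ∪ N_s gives a cover containing S ∖ {s}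
-- that avoids s. Since s ∈ C, this map forgets only C ∩ N_s, so its fibres have
-- at most 2^d(s) elements and |VC(G,S)| ≤ 2^d(s) · |Q|, where Q is the set of
-- covers containing S ∖ {s} and avoiding s. As VC(G, S ∖ {s}) is the disjoint
-- union of VC(G,S) and Q, rearranging gives the bound.
module Submission where

open import Defs
open import Data.Nat using (ℕ; _+_; _*_; _^_; _≤_)
open import Data.Fin using (Fin)
open import Data.Fin.Subset using (Subset; _∈_; _-_)

open import Data.Nat using (suc; z≤n; s≤s)
open import Data.Nat.Properties using (*-zeroʳ; n≤1+n; ≤-refl; ≤-trans; ≤-reflexive; +-mono-≤; +-suc; m≤m+n; +-identityʳ; *-suc; *-comm; *-distribˡ-+; +-comm; module ≤-Reasoning)
open import Data.Bool using (Bool; true; false)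
open import Data.Bool.Properties using () renaming (_≟_ to _≟ᵇ_)
open import Data.Fin.Properties using () renaming (_≟_ to _≟ᶠ_)
open import Data.Fin.Subset using (_∉_; _⊆_; _─_; _∪_; ⁅_⁆; ∣_∣; inside; outside)
open import Data.Fin.Subset.Properties using (_⊆?_; _∈?_; drop-there; p─q⊆p; x∈p∧x≢y⇒x∈p-y; x∈p∪q⁺; x∈p∪q⁻; x∈⁅x⁆; x∈⁅y⁆⇒x≡y; x∉⁅y⁆⇒x≢y)
open import Data.Vec using ([]; _∷_; here; there; tabulate)
open import Data.Vec.Properties using (≡-dec; lookup∘tabulate; lookup⇒[]=)
open import Data.List using ([]; _∷_; map; _++_; filter; length)
open import Data.List.Properties using (length-filter; length-++; filter-++; filter-none; filter-≐)
open import Data.List.Relation.Unary.All using (universal)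
open import Data.List.Relation.Unary.Any using (here; there)
open import Data.List.Membership.Propositional using () renaming (_∈_ to _∈ˡ_)
open import Data.List.Membership.Propositional.Properties using (∈-++⁺ˡ; ∈-++⁺ʳ; ∈-map⁺; ∈-filter⁺)
open import Data.Sum using (_⊎_; inj₁; inj₂; [_,_]; swap)
open import Data.Product using (_×_; _,_)
open import Function using (_∘_; _⇔_; mk⇔; Equivalence)
open import Relation.Binary.Definitions using (DecidableEquality)
open import Relation.Binary.PropositionalEquality as ≡ using (_≡_; _≢_; refl; trans; cong)
open import Relation.Nullary using (¬_; yes; no; contradiction; _×-dec_)
open import Level using (0ℓ)
open import Relation.Unary using (Pred; Decidable; _≐_; _∩_; ∁) renaming (_⊆_ to _⇒_)
open import Relation.Unary.Properties using (_∩?_; ∁?)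

private
  variable
    A B : Set
    n : ℕ

module _ {P : Pred A 0ℓ} (P? : Decidable P) where

  length-filter-none : (∀ x → ¬ P x) → ∀ xs → length (filter P? xs) ≡ 0
  length-filter-none ¬P xs = cong length (filter-none P? (universal ¬P xs))

  length-filter-mono : {Q : Pred A 0ℓ} (Q? : Decidable Q) → P ⇒ Q → ∀ xs →
    length (filter P? xs) ≤ length (filter Q? xs)
  length-filter-mono Q? P⇒Q [] = z≤n
  length-filter-mono Q? P⇒Q (x ∷ xs) with P? x | Q? x
  ... | yes _  | yes _  = s≤s (length-filter-mono Q? P⇒Q xs)
  ... | yes px | no ¬qx = contradiction (P⇒Q px) ¬qx
  ... | no _   | yes _  = ≤-trans (length-filter-mono Q? P⇒Q xs) (n≤1+n _)
  ... | no _   | no _   = length-filter-mono Q? P⇒Q xs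

  length-filter-split : {Q : Pred A 0ℓ} (Q? : Decidable Q) → ∀ xs →
    length (filter P? xs) ≡ length (filter (P? ∩? Q?) xs) + length (filter (P? ∩? ∁? Q?) xs)
  length-filter-split Q? [] = refl
  length-filter-split Q? (x ∷ xs) with P? x | Q? x
  ... | yes _ | yes _ = cong suc (length-filter-split Q? xs)
  ... | yes _ | no _  = trans (cong suc (length-filter-split Q? xs)) (≡.sym (+-suc _ _))
  ... | no _  | _     = length-filter-split Q? xs

  length-filter-map : (f : B → A) → ∀ xs →
    length (filter P? (map f xs)) ≡ length (filter (P? ∘ f) xs)
  length-filter-map f [] = refl
  length-filter-map f (x ∷ xs) with P? (f x)
  ... | yes _ = cong suc (length-filter-map f xs)
  ... | no _  = length-filter-map f xs

module _ (_≟_ : DecidableEquality B) (f : A → B) where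

  length-filter-≤-fibres : {P : Pred A 0ℓ} (P? : Decidable P) {k : ℕ} → ∀ xs ys →
    (∀ {x} → P x → f x ∈ˡ ys) →
    (∀ y → length (filter (P? ∩? λ x → f x ≟ y) xs) ≤ k) →
    length (filter P? xs) ≤ k * length ys
  length-filter-≤-fibres P? {k} xs [] into _ =
    ≤-reflexive (trans (length-filter-none P? (λ x px → contradiction (into px) λ ()) xs) (≡.sym (*-zeroʳ k)))
  length-filter-≤-fibres {P} P? {k} xs (y ∷ ys) into fibre = begin
    length (filter P? xs)
      ≡⟨ length-filter-split P? fy? xs ⟩
    length (filter (P? ∩? fy?) xs) + length (filter (P? ∩? ∁? fy?) xs)
      ≤⟨ +-mono-≤ (fibre y) (length-filter-≤-fibres (P? ∩? ∁? fy?) xs ys into′ fibre′) ⟩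
    k + k * length ys
      ≡⟨ *-suc k _ ⟨
    k * length (y ∷ ys) ∎
    where
    open ≤-Reasoning
    fy? : Decidable (λ x → f x ≡ y)
    fy? x = f x ≟ y
    into′ : ∀ {x} → P x × f x ≢ y → f x ∈ˡ ys
    into′ (px , fx≢y) with into px
    ... | here fx≡y   = contradiction fx≡y fx≢y
    ... | there fx∈ys = fx∈ys
    fibre′ : ∀ y′ → length (filter ((P? ∩? ∁? fy?) ∩? λ x → f x ≟ y′) xs) ≤ k
    fibre′ y′ = ≤-trans (length-filter-mono _ (P? ∩? λ x → f x ≟ y′) (λ ((px , _) , fx≡y′) → px , fx≡y′) xs) (fibre y′)

∈-allSubsets : (C : Subset n) → C ∈ˡ allSubsets n
∈-allSubsets [] = here refl
∈-allSubsets (true ∷ C) = ∈-++⁺ˡ (∈-map⁺ (true ∷_) (∈-allSubsets C))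
∈-allSubsets {suc n} (false ∷ C) = ∈-++⁺ʳ (map (true ∷_) (allSubsets n)) (∈-map⁺ (false ∷_) (∈-allSubsets C))

length-filter-allSubsets : {P : Pred (Subset (suc n)) 0ℓ} (P? : Decidable P) →
  length (filter P? (allSubsets (suc n))) ≡
  length (filter (P? ∘ (true ∷_)) (allSubsets n)) + length (filter (P? ∘ (false ∷_)) (allSubsets n))
length-filter-allSubsets {n} P? = begin
  length (filter P? (map (true ∷_) (allSubsets n) ++ map (false ∷_) (allSubsets n)))
    ≡⟨ cong length (filter-++ P? (map (true ∷_) (allSubsets n)) _) ⟩
  length (filter P? (map (true ∷_) (allSubsets n)) ++ filter P? (map (false ∷_) (allSubsets n)))
    ≡⟨ length-++ (filter P? (map (true ∷_) (allSubsets n))) ⟩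
  length (filter P? (map (true ∷_) (allSubsets n))) + length (filter P? (map (false ∷_) (allSubsets n)))
    ≡⟨ ≡.cong₂ _+_ (length-filter-map P? (true ∷_) (allSubsets n)) (length-filter-map P? (false ∷_) (allSubsets n)) ⟩
  length (filter (P? ∘ (true ∷_)) (allSubsets n)) + length (filter (P? ∘ (false ∷_)) (allSubsets n)) ∎
  where open ≡.≡-Reasoning

x∈p─q⇒x∉q : {x : Fin n} {p q : Subset n} → x ∈ p ─ q → x ∉ q
x∈p─q⇒x∉q {p = _ ∷ _} {outside ∷ _} here      ()
x∈p─q⇒x∉q {p = _ ∷ _} {_ ∷ _}       (there m) (there m′) = x∈p─q⇒x∉q m m′

p-x⊆q⇒x∈q⇒p⊆q : {x : Fin n} {p q : Subset n} → p - x ⊆ q → x ∈ q → p ⊆ q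
p-x⊆q⇒x∈q⇒p⊆q {x = x} p-x⊆q x∈q {y} y∈p with y ≟ᶠ x
... | yes refl = x∈q
... | no y≢x   = p-x⊆q (x∈p∧x≢y⇒x∈p-y y∈p y≢x)

AgreeOutside : Subset n → Subset n → Subset n → Set
AgreeOutside M C E = ∀ {i} → i ∉ M → (i ∈ C ⇔ i ∈ E)

agreeOutside-tail : ∀ {m c e} {M C E : Subset n} →
  AgreeOutside (m ∷ M) (c ∷ C) (e ∷ E) → AgreeOutside M C E
agreeOutside-tail agree i∉M = mk⇔ (drop-there ∘ to ∘ there) (drop-there ∘ from ∘ there)
  where open Equivalence (agree (i∉M ∘ drop-there))

agreeOutside-head : ∀ {c e} {M C E : Subset n} →
  AgreeOutside (outside ∷ M) (c ∷ C) (e ∷ E) → c ≡ e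
agreeOutside-head {c = true}  {true}  agree = refl
agreeOutside-head {c = false} {false} agree = refl
agreeOutside-head {c = true}  {false} agree with () ← Equivalence.to (agree λ ()) here
agreeOutside-head {c = false} {true}  agree with () ← Equivalence.from (agree λ ()) here

length-filter-agreeing≤2^∣M∣ : {P : Pred (Subset n) 0ℓ} (P? : Decidable P) (M E : Subset n) →
  (∀ {C} → P C → AgreeOutside M C E) → length (filter P? (allSubsets n)) ≤ 2 ^ ∣ M ∣
length-filter-agreeing≤2^∣M∣ P? [] [] _ = length-filter P? ([] ∷ [])
length-filter-agreeing≤2^∣M∣ {suc n} P? (inside ∷ M) (e ∷ E) agree = begin
  length (filter P? (allSubsets (suc n)))  ≡⟨ length-filter-allSubsets P? ⟩
  half true + half false                   ≤⟨ +-mono-≤ (half≤ true) (≤-trans (half≤ false) (m≤m+n _ 0)) ⟩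
  2 ^ ∣ M ∣ + (2 ^ ∣ M ∣ + 0)              ∎
  where
  open ≤-Reasoning
  half : Bool → ℕ
  half b = length (filter (P? ∘ (b ∷_)) (allSubsets n))
  half≤ : ∀ b → half b ≤ 2 ^ ∣ M ∣
  half≤ b = length-filter-agreeing≤2^∣M∣ (P? ∘ (b ∷_)) M E (agreeOutside-tail ∘ agree)
length-filter-agreeing≤2^∣M∣ {suc n} P? (outside ∷ M) (e ∷ E) agree = begin
  length (filter P? (allSubsets (suc n)))  ≡⟨ length-filter-allSubsets P? ⟩
  half true + half false                   ≤⟨ bound e refl ⟩
  2 ^ ∣ M ∣                                ∎
  where
  open ≤-Reasoning
  half : Bool → ℕ
  half b = length (filter (P? ∘ (b ∷_)) (allSubsets n))
  half≤ : ∀ b → half b ≤ 2 ^ ∣ M ∣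
  half≤ b = length-filter-agreeing≤2^∣M∣ (P? ∘ (b ∷_)) M E (agreeOutside-tail ∘ agree)
  half≡0 : ∀ b → b ≢ e → half b ≡ 0
  half≡0 b b≢e = length-filter-none (P? ∘ (b ∷_)) (λ C p → b≢e (agreeOutside-head (agree p))) (allSubsets n)
  bound : ∀ b → e ≡ b → half true + half false ≤ 2 ^ ∣ M ∣
  bound true  refl = ≤-trans (≤-reflexive (trans (cong (half true +_) (half≡0 false λ ())) (+-identityʳ _))) (half≤ true)
  bound false refl = ≤-trans (≤-reflexive (cong (_+ half false) (half≡0 true λ ()))) (half≤ false)

_≟ˢ_ : DecidableEquality (Subset n)
_≟ˢ_ = ≡-dec _≟ᵇ_

m≤k*n⇒m*[1+k]≤k*[m+n] : ∀ {m n} k → m ≤ k * n → m * (1 + k) ≤ k * (m + n)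
m≤k*n⇒m*[1+k]≤k*[m+n] {m} {n} k m≤k*n = begin
  m * (1 + k)   ≡⟨ *-suc m k ⟩
  m + m * k     ≡⟨ cong (m +_) (*-comm m k) ⟩
  m + k * m     ≤⟨ +-mono-≤ m≤k*n ≤-refl ⟩
  k * n + k * m ≡⟨ *-distribˡ-+ k n m ⟨
  k * (n + m)   ≡⟨ cong (k *_) (+-comm n m) ⟩
  k * (m + n)   ∎
  where open ≤-Reasoning

module _ (G : Graph n) where

  VC : Subset n → Pred (Subset n) 0ℓ
  VC S C = S ⊆ C × IsVertexCover G C

  VC? : ∀ S → Decidable (VC S)
  VC? S C = (S ⊆? C) ×-dec isVertexCover? G C

  edge-sym : ∀ {u v} → Edge G u v → Edge G v u
  edge-sym {u} {v} e = trans (≡.sym (sym G u v)) e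

  edge⇒≢ : ∀ {u v} → Edge G u v → v ≢ u
  edge⇒≢ {u} e refl = contradiction (trans (≡.sym e) (irrefl G u)) λ ()

  ∈-nbhd⁺ : ∀ {s v} → Edge G s v → v ∈ nbhd G s
  ∈-nbhd⁺ {s} {v} e = lookup⇒[]= v (nbhd G s) (trans (lookup∘tabulate (adj G s) v) e)

  module _ (s : Fin n) where

    trade : Subset n → Subset n
    trade C = (C ∪ nbhd G s) - s

    ∈-trade⁺ : ∀ {C i} → i ∈ C ⊎ i ∈ nbhd G s → i ≢ s → i ∈ trade C
    ∈-trade⁺ i∈C∪N i≢s = x∈p∧x≢y⇒x∈p-y (x∈p∪q⁺ i∈C∪N) i≢s

    ∈-trade⁻ : ∀ {C i} → i ∈ trade C → i ∈ C ⊎ i ∈ nbhd G s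
    ∈-trade⁻ {C} i∈trade = x∈p∪q⁻ C (nbhd G s) (p─q⊆p _ _ i∈trade)

    s∉trade : ∀ {C} → s ∉ trade C
    s∉trade s∈trade = x∈p─q⇒x∉q s∈trade (x∈⁅x⁆ s)

    trade-isVertexCover : ∀ {C} → IsVertexCover G C → IsVertexCover G (trade C)
    trade-isVertexCover {C} vc u v e = [ cover u v e , swap ∘ cover v u (edge-sym e) ] (vc u v e)
      where
      cover : ∀ u v → Edge G u v → u ∈ C → u ∈ trade C ⊎ v ∈ trade C
      cover u v e u∈C with u ≟ᶠ s
      ... | yes refl = inj₂ (∈-trade⁺ (inj₂ (∈-nbhd⁺ e)) (edge⇒≢ e))
      ... | no u≢s   = inj₁ (∈-trade⁺ (inj₁ u∈C) u≢s)

    AvoidingVC : Subset n → Pred (Subset n) 0ℓ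
    AvoidingVC S = VC (S - s) ∩ ∁ (s ∈_)

    AvoidingVC? : ∀ S → Decidable (AvoidingVC S)
    AvoidingVC? S = VC? (S - s) ∩? ∁? (s ∈?_)

    trade-avoidingVC : ∀ {S C} → VC S C → AvoidingVC S (trade C)
    trade-avoidingVC (S⊆C , vc) = (S-s⊆trade , trade-isVertexCover vc) , s∉trade
      where
      S-s⊆trade : ∀ {x} → x ∈ _ - s → x ∈ trade _
      S-s⊆trade x∈S-s = ∈-trade⁺ (inj₁ (S⊆C (p─q⊆p _ _ x∈S-s))) (x∉⁅y⁆⇒x≢y (x∈p─q⇒x∉q x∈S-s))

    trade-agreeOutside : ∀ {S C} → s ∈ S → VC S C → AgreeOutside (nbhd G s) C (trade C ∪ ⁅ s ⁆)
    trade-agreeOutside {C = C} s∈S (S⊆C , _) {i} i∉N = mk⇔ to from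
      where
      to : i ∈ C → i ∈ trade C ∪ ⁅ s ⁆
      to i∈C with i ≟ᶠ s
      ... | yes refl = x∈p∪q⁺ (inj₂ (x∈⁅x⁆ s))
      ... | no i≢s   = x∈p∪q⁺ (inj₁ (∈-trade⁺ (inj₁ i∈C) i≢s))
      from : i ∈ trade C ∪ ⁅ s ⁆ → i ∈ C
      from i∈ with x∈p∪q⁻ (trade C) ⁅ s ⁆ i∈
      ... | inj₂ i∈⁅s⁆ = ≡.subst (_∈ C) (≡.sym (x∈⁅y⁆⇒x≡y s i∈⁅s⁆)) (S⊆C s∈S)
      ... | inj₁ i∈trade with ∈-trade⁻ i∈trade
      ...   | inj₁ i∈C = i∈C
      ...   | inj₂ i∈N = contradiction i∈N i∉N

    trade-fibre≤2^deg : ∀ {S} → s ∈ S → ∀ D →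
      length (filter (VC? S ∩? λ C → trade C ≟ˢ D) (allSubsets n)) ≤ 2 ^ deg G s
    trade-fibre≤2^deg s∈S D = length-filter-agreeing≤2^∣M∣ _ (nbhd G s) (D ∪ ⁅ s ⁆) λ (vc , trade≡D) →
      ≡.subst (λ X → AgreeOutside (nbhd G s) _ (X ∪ ⁅ s ⁆)) trade≡D (trade-agreeOutside s∈S vc)

    numVC≤2^deg*avoiding : ∀ {S} → s ∈ S →
      numVC G S ≤ 2 ^ deg G s * length (filter (AvoidingVC? S) (allSubsets n))
    numVC≤2^deg*avoiding {S} s∈S =
      length-filter-≤-fibres _≟ˢ_ trade (VC? S) (allSubsets n) (filter (AvoidingVC? S) (allSubsets n))
        (λ {C} vc → ∈-filter⁺ (AvoidingVC? S) (∈-allSubsets (trade C)) (trade-avoidingVC vc))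
        (trade-fibre≤2^deg s∈S)

    VC-S-s∩∋s≐VC-S : ∀ {S} → s ∈ S → VC (S - s) ∩ (s ∈_) ≐ VC S
    VC-S-s∩∋s≐VC-S {S} s∈S =
      (λ ((S-s⊆C , vc) , s∈C) → p-x⊆q⇒x∈q⇒p⊆q S-s⊆C s∈C , vc) ,
      (λ (S⊆C , vc) → (S⊆C ∘ p─q⊆p S ⁅ s ⁆ , vc) , S⊆C s∈S)

    numVC-S-s≡numVC+avoiding : ∀ {S} → s ∈ S →
      numVC G (S - s) ≡ numVC G S + length (filter (AvoidingVC? S) (allSubsets n))
    numVC-S-s≡numVC+avoiding {S} s∈S =
      trans (length-filter-split (VC? (S - s)) (s ∈?_) (allSubsets n))
            (cong (_+ length (filter (AvoidingVC? S) (allSubsets n)))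
                  (cong length (filter-≐ _ (VC? S) (VC-S-s∩∋s≐VC-S s∈S) (allSubsets n))))

theorem15 : ∀ {n} (G : Graph n) (S : Subset n) (s : Fin n) → s ∈ S →
    numVC G S * (1 + 2 ^ deg G s) ≤ 2 ^ deg G s * numVC G (S - s)
theorem15 G S s s∈S = begin
  numVC G S * (1 + 2 ^ deg G s) ≤⟨ m≤k*n⇒m*[1+k]≤k*[m+n] _ (numVC≤2^deg*avoiding G s s∈S) ⟩
  2 ^ deg G s * (numVC G S + _) ≡⟨ cong (2 ^ deg G s *_) (numVC-S-s≡numVC+avoiding G s s∈S) ⟨
  2 ^ deg G s * numVC G (S - s) ∎
  where open ≤-Reasoning
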